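{- Let $D$ be a finite directed graph and let $F \subseteq E(D)$ be a set of edges. Then \[ \max \{|F \cap E(\mathcal{C})| \colon \mathcal{C} \text{ is a collection of edge-disjoint (directed) cycles of } D \} \;\ge\;\min \{|Y| \colon Y \subseteq E(D) \text{ hits all $F$-cycles in } D\}. \]
   Context: Cycles in $D$ are directed cycles. An $F$-cycle is a directed cycle of $D$ containing at least one edge of $F$. For a collection $\mathcal{C}$ of cycles, $E(\mathcal{C})$ denotes the set of all edges contained in some cycle of $\mathcal{C}$. A set $Y$ of edges hits a cycle if the cycle contains an edge of $Y$. -}

module Defs where

open import Data.Nat using (ℕ; _≤_)
open import Data.Fin using (Fin; _≟_)
open import Data.Fin.Subset using (Subset; _∩_; ∣_∣) renaming (_∈_ to _∈ₛ_)
open import Data.Vec using (tabulate)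
open import Data.List using (List; []; _∷_; map)
open import Data.Bool.ListAction using (any)
open import Data.List.Membership.Propositional using (_∈_)
open import Data.List.Relation.Unary.Unique.Propositional using (Unique)
open import Data.List.Relation.Unary.All using (All)
open import Data.List.Relation.Unary.AllPairs using (AllPairs)
open import Data.Product using (Σ; _×_; ∃-syntax)
open import Data.Empty using (⊥)
open import Relation.Binary.PropositionalEquality using (_≡_)
open import Relation.Nullary using (¬_)
open import Relation.Nullary.Decidable using (⌊_⌋)

record Digraph : Set where
  field
    nV   : ℕ
    nE   : ℕ
    tail : Fin nE → Fin nV
    head : Fin nE → Fin nV
open Digraph public

module _ (D : Digraph) where

  Walk : Fin (nV D) → Fin (nV D) → List (Fin (nE D)) → Set
  Walk v w []       = v ≡ w
  Walk v w (e ∷ es) = (tail D e ≡ v) × Walk (head D e) w es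

  -- A directed cycle: a nonempty closed walk with pairwise distinct vertices
  -- (the tails of its edges), given as its cyclic sequence of edges.
  IsCycle : List (Fin (nE D)) → Set
  IsCycle []       = ⊥
  IsCycle (e ∷ es) = Walk (tail D e) (tail D e) (e ∷ es) × Unique (map (tail D) (e ∷ es))

  IsFCycle : Subset (nE D) → List (Fin (nE D)) → Set
  IsFCycle F c = IsCycle c × ∃[ e ] (e ∈ c × e ∈ₛ F)

  Hits : Subset (nE D) → List (Fin (nE D)) → Set
  Hits Y c = ∃[ e ] (e ∈ c × e ∈ₛ Y)

  HitsAllFCycles : Subset (nE D) → Subset (nE D) → Set
  HitsAllFCycles F Y = ∀ c → IsFCycle F c → Hits Y c

  EdgeDisjoint : List (Fin (nE D)) → List (Fin (nE D)) → Set
  EdgeDisjoint c c' = ∀ e → e ∈ c → ¬ (e ∈ c')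

  IsEdgeDisjointCycleCollection : List (List (Fin (nE D))) → Set
  IsEdgeDisjointCycleCollection C = All IsCycle C × AllPairs EdgeDisjoint C

  EdgesOf : List (List (Fin (nE D))) → Subset (nE D)
  EdgesOf C = tabulate (λ e → any (λ c → any (λ e' → ⌊ e ≟ e' ⌋) c) C)

-- Edge-disjoint cycle collections are exactly the 0/1 circulations f, and |F ∩ E(C)| is the weight
-- of f for w = the indicator of F; so it suffices to treat arbitrary integer weights w.  Starting from
-- f = ∅, augment f along cycles of positive weight in the residual graph (the edges of f reversed,
-- with negated weights).  When there are none left, longest-walk distances give a potential q with
-- reduced weight w e + q (head e) - q (tail e) at most 0 off f and at least 0 on f.  Let Y be the set of
-- edges of positive reduced weight.  Along a cycle the potential telescopes away, so a cycle of
-- positive weight has an edge in Y; over the circulation f it telescopes away as well, so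
-- |Y| ≤ Σ_{e ∈ f} (reduced weight of e) = w(f).

module Submission where

open import Defs

-- Inside this module _≤_ is the order on ℤ; the statement's order on ℕ is opened only after it.
module WeightedCycles where

  import Data.Integer.Properties as ℤP
  open import Algebra.Properties.CommutativeMonoid.Sum ℤP.+-0-commutativeMonoid
    using (sum; sum-syntax; sum-cong-≗; sum-replicate-zero; ∑-distrib-+)
  open import Algebra.Properties.CommutativeSemigroup ℤP.+-commutativeSemigroup
    using (interchange; x∙yz≈y∙xz)
  open import Data.Bool using (Bool; true; false; T; _∧_; _∨_; _xor_; if_then_else_)
  open import Data.Bool.ListAction using (any)
  open import Data.Bool.Properties using (T-≡; xor-identityʳ)
  open import Data.Fin using (Fin; zero; suc; _≟_)
  import Data.Fin.Properties as Fin
  open import Data.Fin.Subset using (Subset; ∣_∣; _∩_) renaming (_∈_ to _∈ₛ_)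
  open import Data.Integer as ℤ
    using (ℤ; +_; -[1+_]; 0ℤ; 1ℤ; -_; _+_; _-_; _⊔_; _≤_; _<_; _≤?_; _<?_; +≤+; +<+; -≤+)
  open import Data.Integer.Tactic.RingSolver using (solve-∀)
  open import Data.List using (List; []; _∷_; _++_; map; length; filter; allFin)
  import Data.List as List
  open import Data.List.Extrema ℤP.≤-totalOrder using (max; ⊥≤max; xs≤max; argmax-sel)
  open import Data.List.Membership.Propositional using (_∈_; find; lose)
  open import Data.List.Membership.Propositional.Properties
    using (∈-∃++; ∈-lookup; ∈-allFin; ∈-filter⁺; ∈-map⁺; ∈-map∘filter⁻)
  open import Data.List.Properties using (length-map; length-++-≤ʳ)
  open import Data.List.Relation.Binary.Subset.Propositional using (_⊆_)
  open import Data.List.Relation.Binary.Subset.Propositional.Properties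
    using (⊆-trans; xs⊆xs++ys; xs⊆ys++xs; ++⁺ʳ)
  open import Data.List.Relation.Unary.All as All using (All; []; _∷_)
  open import Data.List.Relation.Unary.All.Properties using (¬Any⇒All¬; All¬⇒¬Any; anti-mono; map⁺)
  open import Data.List.Relation.Unary.AllPairs using ([]; _∷_)
  open import Data.List.Relation.Unary.Any as Any using (here; there)
  open import Data.List.Relation.Unary.Any.Properties using (any⁺; any⁻)
  open import Data.List.Relation.Unary.Unique.Propositional using (Unique)
  import Data.List.Relation.Unary.Unique.Propositional.Properties as Unique
  open import Data.Nat as ℕ using (ℕ; zero; suc; z≤n; s≤s)
  import Data.Nat.Properties as ℕP
  open import Data.Nat.Induction using (<-wellFounded)
  open import Data.Product using (_×_; _,_; proj₁; ∃-syntax)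
  open import Data.Sum using (_⊎_; inj₁; inj₂)
  open import Data.Vec using (lookup; tabulate)
  import Data.Vec as Vec
  open import Data.Vec.Properties
    using (lookup∘tabulate; lookup-zipWith; lookup⇒[]=; []=⇒lookup)
  open import Function using (id; _∘_)
  open import Function.Bundles using (Equivalence)
  open import Induction.WellFounded using (Acc; acc)
  open import Relation.Binary.Definitions using (DecidableEquality)
  open import Relation.Binary.PropositionalEquality
  open import Relation.Nullary using (¬_; Dec; yes; no; contradiction)
  open import Relation.Nullary.Decidable
    using (⌊_⌋; T?; toWitness; fromWitness; dec-true; dec-false; isYes≗does; ⌊⌋-map′; _×-dec_)

  -- Sums over finite sets and lists

  infixr 7 _·_

  _·_ : Bool → ℤ → ℤ
  true  · x = x
  false · x = 0ℤ

  negateIf : Bool → ℤ → ℤ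
  negateIf true  x = - x
  negateIf false x = x

  ·-T : ∀ {b} → T b → ∀ x → b · x ≡ x
  ·-T {true} _ x = refl

  negateIf-T : ∀ {b} → T b → ∀ x → negateIf b x ≡ - x
  negateIf-T {true} _ x = refl

  ·-distrib-+ : ∀ b x y → b · (x + y) ≡ b · x + b · y
  ·-distrib-+ true  x y = refl
  ·-distrib-+ false x y = refl

  xor-· : ∀ b m x → (b xor m) · x ≡ b · x + m · negateIf b x
  xor-· false false x = refl
  xor-· false true  x = sym (ℤP.+-identityˡ x)
  xor-· true  false x = sym (ℤP.+-identityʳ x)
  xor-· true  true  x = sym (ℤP.+-inverseʳ x)

  xor-T : ∀ {a b} → T a → T b → ¬ T (a xor b)
  xor-T {true} {true} _ _ ()

  isYes-true : ∀ {A : Set} (a? : Dec A) → A → ⌊ a? ⌋ ≡ true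
  isYes-true a? a = trans (isYes≗does a?) (dec-true a? a)

  isYes-false : ∀ {A : Set} (a? : Dec A) → ¬ A → ⌊ a? ⌋ ≡ false
  isYes-false a? ¬a = trans (isYes≗does a?) (dec-false a? ¬a)

  0≤b·1 : ∀ b → 0ℤ ≤ b · 1ℤ
  0≤b·1 true  = +≤+ z≤n
  0≤b·1 false = ℤP.≤-refl

  i≤+∣i∣ : ∀ i → i ≤ + ℤ.∣ i ∣
  i≤+∣i∣ (+ n)    = ℤP.≤-refl
  i≤+∣i∣ -[1+ n ] = -≤+

  <-+-nonpositive : ∀ {i j k} → i ≤ 0ℤ → k < i + j → k < j
  <-+-nonpositive {i} {j} i≤0 k<i+j =
    ℤP.<-≤-trans k<i+j (subst (i + j ≤_) (ℤP.+-identityˡ j) (ℤP.+-monoˡ-≤ j i≤0))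

  +-positive : ∀ i j → 0ℤ < i + j → 0ℤ < i ⊎ 0ℤ < j
  +-positive i j 0<i+j with 0ℤ <? i
  ... | yes 0<i = inj₁ 0<i
  ... | no  0≮i = inj₂ (<-+-nonpositive (ℤP.≮⇒≥ 0≮i) 0<i+j)

  positive-summand : ∀ {i j k} → j ≤ k → k < i + j → 0ℤ < i
  positive-summand {i} j≤k k<i+j with 0ℤ <? i
  ... | yes 0<i = 0<i
  ... | no  0≮i = contradiction j≤k (ℤP.<⇒≱ (<-+-nonpositive (ℤP.≮⇒≥ 0≮i) k<i+j))

  ∑-mono-≤ : ∀ {n} {g h : Fin n → ℤ} → (∀ i → g i ≤ h i) → sum g ≤ sum h
  ∑-mono-≤ {zero}  g≤h = ℤP.≤-refl
  ∑-mono-≤ {suc n} g≤h = ℤP.+-mono-≤ (g≤h zero) (∑-mono-≤ (g≤h ∘ suc))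

  ∑-δ : ∀ {n} (j : Fin n) (g : Fin n → ℤ) → ∑[ i < n ] (⌊ i ≟ j ⌋ · g i) ≡ g j
  ∑-δ {suc n} zero    g = trans (cong (_+_ (g zero)) (sum-replicate-zero n)) (ℤP.+-identityʳ (g zero))
  ∑-δ {suc n} (suc j) g = begin
    0ℤ + ∑[ i < n ] (⌊ suc i ≟ suc j ⌋ · g (suc i))   ≡⟨ ℤP.+-identityˡ _ ⟩
    ∑[ i < n ] (⌊ suc i ≟ suc j ⌋ · g (suc i))        ≡⟨ sum-cong-≗ (λ i → cong (_· g (suc i)) (⌊⌋-map′ _ _ (i ≟ j))) ⟩
    ∑[ i < n ] (⌊ i ≟ j ⌋ · g (suc i))                ≡⟨ ∑-δ j (g ∘ suc) ⟩
    g (suc j)                                        ∎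
    where open ≡-Reasoning

  ∣p∣≡∑ : ∀ {n} (p : Subset n) → + ∣ p ∣ ≡ ∑[ i < n ] (lookup p i · 1ℤ)
  ∣p∣≡∑ Vec.[]           = refl
  ∣p∣≡∑ (true  Vec.∷ p) = cong (_+_ 1ℤ) (∣p∣≡∑ p)
  ∣p∣≡∑ (false Vec.∷ p) = trans (∣p∣≡∑ p) (sym (ℤP.+-identityˡ _))

  ∣tabulate∣≡∑ : ∀ {n} (f : Fin n → Bool) → + ∣ tabulate f ∣ ≡ ∑[ i < n ] (f i · 1ℤ)
  ∣tabulate∣≡∑ f = trans (∣p∣≡∑ (tabulate f)) (sum-cong-≗ (λ i → cong (_· 1ℤ) (lookup∘tabulate f i)))

  weight : ∀ {A : Set} → (A → ℤ) → List A → ℤ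
  weight g []       = 0ℤ
  weight g (x ∷ xs) = g x + weight g xs

  module _ {A : Set} where

    weight-++ : ∀ (g : A → ℤ) xs ys → weight g (xs ++ ys) ≡ weight g xs + weight g ys
    weight-++ g []       ys = sym (ℤP.+-identityˡ _)
    weight-++ g (x ∷ xs) ys = trans (cong (_+_ (g x)) (weight-++ g xs ys)) (sym (ℤP.+-assoc (g x) _ _))

    weight-+ : ∀ (g h : A → ℤ) xs → weight (λ x → g x + h x) xs ≡ weight g xs + weight h xs
    weight-+ g h []       = refl
    weight-+ g h (x ∷ xs) =
      trans (cong (_+_ (g x + h x)) (weight-+ g h xs)) (interchange (g x) (h x) _ _)

    weight-neg : ∀ (g : A → ℤ) xs → weight (λ x → - g x) xs ≡ - weight g xs
    weight-neg g []       = refl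
    weight-neg g (x ∷ xs) = trans (cong (_+_ (- g x)) (weight-neg g xs)) (sym (ℤP.neg-distrib-+ (g x) _))

    weight-cong : ∀ {g h : A → ℤ} xs → (∀ {x} → x ∈ xs → g x ≡ h x) → weight g xs ≡ weight h xs
    weight-cong []       g≡h = refl
    weight-cong (x ∷ xs) g≡h = cong₂ _+_ (g≡h (here refl)) (weight-cong xs (g≡h ∘ there))

    weight-1 : ∀ (xs : List A) → weight (λ _ → 1ℤ) xs ≡ + length xs
    weight-1 []       = refl
    weight-1 (x ∷ xs) = cong (_+_ 1ℤ) (weight-1 xs)

    weight-nonneg : ∀ {g : A → ℤ} → (∀ x → 0ℤ ≤ g x) → ∀ xs → 0ℤ ≤ weight g xs
    weight-nonneg 0≤g []       = ℤP.≤-refl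
    weight-nonneg 0≤g (x ∷ xs) = ℤP.+-mono-≤ (0≤g x) (weight-nonneg 0≤g xs)

    weight-positive : ∀ {g : A → ℤ} → (∀ x → 0ℤ ≤ g x) → ∀ {x xs} → x ∈ xs → 0ℤ < g x → 0ℤ < weight g xs
    weight-positive 0≤g {xs = _ ∷ xs} (here refl) 0<gx = ℤP.+-mono-<-≤ 0<gx (weight-nonneg 0≤g xs)
    weight-positive 0≤g {xs = y ∷ _}  (there x∈xs) 0<gx = ℤP.+-mono-≤-< (0≤g y) (weight-positive 0≤g x∈xs 0<gx)

    positive-term : ∀ (g : A → ℤ) xs → 0ℤ < weight g xs → ∃[ x ] (x ∈ xs × 0ℤ < g x)
    positive-term g []       (+<+ ())
    positive-term g (x ∷ xs) 0<weight with +-positive (g x) (weight g xs) 0<weight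
    ... | inj₁ 0<gx   = x , here refl , 0<gx
    ... | inj₂ 0<rest = let y , y∈xs , 0<gy = positive-term g xs 0<rest in y , there y∈xs , 0<gy

    weight-cut : ∀ (g : A → ℤ) p x q y r →
                 weight g (p ++ x ∷ q ++ y ∷ r) ≡ weight g (x ∷ q) + weight g (p ++ y ∷ r)
    weight-cut g p x q y r = begin
      weight g (p ++ x ∷ q ++ y ∷ r)                        ≡⟨ weight-++ g p _ ⟩
      weight g p + weight g ((x ∷ q) ++ y ∷ r)              ≡⟨ cong (_+_ (weight g p)) (weight-++ g (x ∷ q) _) ⟩
      weight g p + (weight g (x ∷ q) + weight g (y ∷ r))    ≡⟨ x∙yz≈y∙xz (weight g p) (weight g (x ∷ q)) _ ⟩
      weight g (x ∷ q) + (weight g p + weight g (y ∷ r))    ≡⟨ cong (_+_ (weight g (x ∷ q))) (weight-++ g p _) ⟨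
      weight g (x ∷ q) + weight g (p ++ y ∷ r)              ∎
      where open ≡-Reasoning

  _∈ᵇ_ : ∀ {n} → Fin n → List (Fin n) → Bool
  i ∈ᵇ xs = any (λ j → ⌊ i ≟ j ⌋) xs

  module _ {n : ℕ} where

    ∈ᵇ⇒∈ : ∀ {i : Fin n} {xs} → T (i ∈ᵇ xs) → i ∈ xs
    ∈ᵇ⇒∈ = Any.map toWitness ∘ any⁻ _ _

    ∈⇒∈ᵇ : ∀ {i : Fin n} {xs} → i ∈ xs → T (i ∈ᵇ xs)
    ∈⇒∈ᵇ = any⁺ _ ∘ Any.map fromWitness

    ∑-∈ᵇ : ∀ {xs : List (Fin n)} → Unique xs → ∀ (g : Fin n → ℤ) →
           ∑[ i < n ] ((i ∈ᵇ xs) · g i) ≡ weight g xs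
    ∑-∈ᵇ {[]}     _          g = sum-replicate-zero n
    ∑-∈ᵇ {x ∷ xs} (x∉xs ∷ u) g = begin
      ∑[ i < n ] ((⌊ i ≟ x ⌋ ∨ i ∈ᵇ xs) · g i)
        ≡⟨ sum-cong-≗ split ⟩
      ∑[ i < n ] (⌊ i ≟ x ⌋ · g i + (i ∈ᵇ xs) · g i)
        ≡⟨ ∑-distrib-+ (λ i → ⌊ i ≟ x ⌋ · g i) (λ i → (i ∈ᵇ xs) · g i) ⟩
      ∑[ i < n ] (⌊ i ≟ x ⌋ · g i) + ∑[ i < n ] ((i ∈ᵇ xs) · g i)
        ≡⟨ cong₂ _+_ (∑-δ x g) (∑-∈ᵇ u g) ⟩
      g x + weight g xs
        ∎
      where
      open ≡-Reasoning
      split : ∀ i → (⌊ i ≟ x ⌋ ∨ i ∈ᵇ xs) · g i ≡ ⌊ i ≟ x ⌋ · g i + (i ∈ᵇ xs) · g i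
      split i with i ≟ x | i ∈ᵇ xs in i∈ᵇxs
      ... | no _     | _     = sym (ℤP.+-identityˡ _)
      ... | yes _    | false = sym (ℤP.+-identityʳ _)
      ... | yes refl | true  = contradiction (∈ᵇ⇒∈ (subst T (sym i∈ᵇxs) _)) (All¬⇒¬Any x∉xs)

    _⊕_ : (Fin n → Bool) → List (Fin n) → Fin n → Bool
    (f ⊕ xs) i = f i xor (i ∈ᵇ xs)

    ∑-⊕ : ∀ (f : Fin n → Bool) {xs} → Unique xs → ∀ (g : Fin n → ℤ) →
          ∑[ i < n ] ((f ⊕ xs) i · g i) ≡ ∑[ i < n ] (f i · g i) + weight (λ i → negateIf (f i) (g i)) xs
    ∑-⊕ f {xs} u g = begin
      ∑[ i < n ] ((f ⊕ xs) i · g i)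
        ≡⟨ sum-cong-≗ (λ i → xor-· (f i) (i ∈ᵇ xs) (g i)) ⟩
      ∑[ i < n ] (f i · g i + (i ∈ᵇ xs) · g± i)
        ≡⟨ ∑-distrib-+ (λ i → f i · g i) (λ i → (i ∈ᵇ xs) · g± i) ⟩
      ∑[ i < n ] (f i · g i) + ∑[ i < n ] ((i ∈ᵇ xs) · g± i)
        ≡⟨ cong (_+_ (∑[ i < n ] (f i · g i))) (∑-∈ᵇ u g±) ⟩
      ∑[ i < n ] (f i · g i) + weight g± xs
        ∎
      where
      open ≡-Reasoning
      g± : Fin n → ℤ
      g± i = negateIf (f i) (g i)

    ∑-⊖ : ∀ (f : Fin n → Bool) {xs} → Unique xs → All (T ∘ f) xs → ∀ (g : Fin n → ℤ) →
          ∑[ i < n ] ((f ⊕ xs) i · g i) + weight g xs ≡ ∑[ i < n ] (f i · g i)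
    ∑-⊖ f {xs} u xs⊆f g = begin
      ∑[ i < n ] ((f ⊕ xs) i · g i) + weight g xs
        ≡⟨ cong (_+ weight g xs) (∑-⊕ f u g) ⟩
      ∑[ i < n ] (f i · g i) + weight (λ i → negateIf (f i) (g i)) xs + weight g xs
        ≡⟨ cong (λ s → ∑[ i < n ] (f i · g i) + s + weight g xs) negated ⟩
      ∑[ i < n ] (f i · g i) + - weight g xs + weight g xs
        ≡⟨ cancel _ (weight g xs) ⟩
      ∑[ i < n ] (f i · g i)
        ∎
      where
      open ≡-Reasoning
      negated : weight (λ i → negateIf (f i) (g i)) xs ≡ - weight g xs
      negated = trans (weight-cong xs (λ i∈xs → negateIf-T (All.lookup xs⊆f i∈xs) _)) (weight-neg g xs)
      cancel : ∀ a b → a + - b + b ≡ a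
      cancel = solve-∀

    ∣tabulate-⊖∣ : ∀ (f : Fin n → Bool) {xs} → Unique xs → All (T ∘ f) xs →
                   ∣ tabulate (f ⊕ xs) ∣ ℕ.+ length xs ≡ ∣ tabulate f ∣
    ∣tabulate-⊖∣ f {xs} u xs⊆f = ℤP.+-injective (begin
      + ∣ tabulate (f ⊕ xs) ∣ + + length xs                ≡⟨ cong₂ _+_ (∣tabulate∣≡∑ (f ⊕ xs)) (sym (weight-1 xs)) ⟩
      ∑[ i < n ] ((f ⊕ xs) i · 1ℤ) + weight (λ _ → 1ℤ) xs  ≡⟨ ∑-⊖ f u xs⊆f (λ _ → 1ℤ) ⟩
      ∑[ i < n ] (f i · 1ℤ)                                ≡⟨ ∣tabulate∣≡∑ f ⟨
      + ∣ tabulate f ∣                                     ∎)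
      where open ≡-Reasoning

  -- Repetitions in lists

  data DistinctOrRepeat {A B : Set} (t : A → B) : List A → Set where
    distinct : ∀ {xs} → Unique (map t xs) → DistinctOrRepeat t xs
    repeat   : ∀ p x q y r → t x ≡ t y → DistinctOrRepeat t (p ++ x ∷ q ++ y ∷ r)

  distinctOrRepeat : ∀ {A B : Set} → DecidableEquality B → (t : A → B) → ∀ xs → DistinctOrRepeat t xs
  distinctOrRepeat _≟B_ t []       = distinct []
  distinctOrRepeat _≟B_ t (x ∷ xs) with Any.any? (λ y → t x ≟B t y) xs
  ... | yes hit
    with y , y∈xs , tx≡ty ← find hit
    with q , r , refl ← ∈-∃++ y∈xs
    = repeat [] x q y r tx≡ty
  ... | no miss with distinctOrRepeat _≟B_ t xs
  ...   | distinct u               = distinct (map⁺ (¬Any⇒All¬ xs miss) ∷ u)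
  ...   | repeat p y q z r ty≡tz   = repeat (x ∷ p) y q z r ty≡tz

  Unique⇒length≤ : ∀ {n} {xs : List (Fin n)} → Unique xs → length xs ℕ.≤ n
  Unique⇒length≤ {n} {xs} u with length xs ℕ.≤? n
  ... | yes ≤n = ≤n
  ... | no  ≰n with i , j , i<j , same ← Fin.pigeonhole (ℕP.≰⇒> ≰n) (List.lookup xs)
    = contradiction (lookup-injective u i j same) (Fin.<⇒≢ i<j)
    where
    lookup-injective : ∀ {ys : List (Fin n)} → Unique ys → ∀ i j →
                       List.lookup ys i ≡ List.lookup ys j → i ≡ j
    lookup-injective (_  ∷ _) zero    zero    _  = refl
    lookup-injective (y∉ ∷ _) zero    (suc j) eq = contradiction eq (All.lookup y∉ (∈-lookup j))
    lookup-injective (y∉ ∷ _) (suc i) zero    eq = contradiction (sym eq) (All.lookup y∉ (∈-lookup i))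
    lookup-injective (_  ∷ u) (suc i) (suc j) eq = cong suc (lookup-injective u i j eq)

  module _ {A : Set} where

    loop-shorter : ∀ (p : List A) x q y r → length (x ∷ q) ℕ.< length (p ++ x ∷ q ++ y ∷ r)
    loop-shorter (_ ∷ p) x q       y r = ℕP.m<n⇒m<1+n (loop-shorter p x q y r)
    loop-shorter []      x []      y r = s≤s (s≤s z≤n)
    loop-shorter []      x (z ∷ q) y r = s≤s (loop-shorter [] z q y r)

    shortcut-shorter : ∀ (p : List A) x q y r → length (p ++ y ∷ r) ℕ.< length (p ++ x ∷ q ++ y ∷ r)
    shortcut-shorter (_ ∷ p) x q y r = s≤s (shortcut-shorter p x q y r)
    shortcut-shorter []      x q y r = s≤s (length-++-≤ʳ (y ∷ r) {q})

    loop⊆ : ∀ (p : List A) x q y r → x ∷ q ⊆ p ++ x ∷ q ++ y ∷ r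
    loop⊆ p x q y r = ⊆-trans (xs⊆xs++ys (x ∷ q) (y ∷ r)) (xs⊆ys++xs _ p)

    shortcut⊆ : ∀ (p : List A) x q y r → p ++ y ∷ r ⊆ p ++ x ∷ q ++ y ∷ r
    shortcut⊆ p x q y r = ++⁺ʳ p (xs⊆ys++xs (y ∷ r) (x ∷ q))

  -- Walks and cycles

  Edge Vertex : Digraph → Set
  Edge G   = Fin (nE G)
  Vertex G = Fin (nV G)

  IsFeasiblePotential : (G : Digraph) → (Edge G → ℤ) → (Vertex G → ℤ) → Set
  IsFeasiblePotential G c q = ∀ e → c e + q (head G e) ≤ q (tail G e)

  module _ (G : Digraph) where

    Δ : (Vertex G → ℤ) → Edge G → ℤ
    Δ q e = q (head G e) - q (tail G e)

    weight-Δ : ∀ q {x y} es → Walk G x y es → weight (Δ q) es ≡ q y - q x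
    weight-Δ q {x}     []       refl       = sym (ℤP.+-inverseʳ (q x))
    weight-Δ q {y = y} (e ∷ es) (refl , w) =
      trans (cong (_+_ (Δ q e)) (weight-Δ q es w)) (telescope (q (head G e)) (q (tail G e)) (q y))
      where
      telescope : ∀ a b c → (a - b) + (c - a) ≡ c - b
      telescope = solve-∀

    cycle-unique : ∀ {cy} → IsCycle G cy → Unique cy
    cycle-unique {_ ∷ _} (_ , distinctTails) = Unique.map⁻ distinctTails

    cycle-Δ : ∀ q {cy} → IsCycle G cy → weight (Δ q) cy ≡ 0ℤ
    cycle-Δ q {e ∷ es} (closed , _) = trans (weight-Δ q (e ∷ es) closed) (ℤP.+-inverseʳ (q (tail G e)))

    distinctTails⇒length≤ : ∀ {es} → Unique (map (tail G) es) → length es ℕ.≤ nV G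
    distinctTails⇒length≤ {es} u = subst (ℕ._≤ nV G) (length-map (tail G) es) (Unique⇒length≤ u)

    walk-split : ∀ {x z} p {s} → Walk G x z (p ++ s) → ∃[ y ] (Walk G x y p × Walk G y z s)
    walk-split {x} []      w       = x , refl , w
    walk-split     (e ∷ p) (t , w) = let y , wp , ws = walk-split p w in y , (t , wp) , ws

    cut-loop : ∀ {x z} p {e q e′ r} → tail G e ≡ tail G e′ → Walk G x z (p ++ e ∷ q ++ e′ ∷ r) →
               Walk G (tail G e) (tail G e) (e ∷ q) × Walk G x z (p ++ e′ ∷ r)
    cut-loop [] {q = q} same (refl , w) with _ , wq , refl , wr ← walk-split q w =
      (refl , subst (λ u → Walk G _ u q) (sym same) wq) , sym same , wr
    cut-loop (_ ∷ p) same (t , w) = let loop , rest = cut-loop p same w in loop , (t , rest)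

    PositiveCycleWithin : (Edge G → ℤ) → List (Edge G) → Set
    PositiveCycleWithin c es = ∃[ cy ] (IsCycle G cy × 0ℤ < weight c cy × cy ⊆ es)

    closedWalk⇒positiveCycle : ∀ c {x es} → Walk G x x es → 0ℤ < weight c es → PositiveCycleWithin c es
    closedWalk⇒positiveCycle c w pos = go (<-wellFounded _) w pos
      where
      widen : ∀ {es es′} → es ⊆ es′ → PositiveCycleWithin c es → PositiveCycleWithin c es′
      widen es⊆es′ (cy , cycle , pos , cy⊆es) = cy , cycle , pos , es⊆es′ ∘ cy⊆es

      distinct-closed : ∀ {x es} → Walk G x x es → Unique (map (tail G) es) → 0ℤ < weight c es → IsCycle G es
      distinct-closed {es = []}    _          _ (+<+ ())
      distinct-closed {es = _ ∷ _} (refl , w) u _ = (refl , w) , u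

      go : ∀ {x es} → Acc ℕ._<_ (length es) → Walk G x x es → 0ℤ < weight c es → PositiveCycleWithin c es
      go {es = es} (acc shorter) w pos with distinctOrRepeat _≟_ (tail G) es
      ... | distinct u = es , distinct-closed w u pos , pos , id
      ... | repeat p e q e′ r same
        with loop , rest ← cut-loop p same w
        with +-positive _ _ (subst (0ℤ <_) (weight-cut c p e q e′ r) pos)
      ... | inj₁ 0<loop = widen (loop⊆ p e q e′ r) (go (shorter (loop-shorter p e q e′ r)) loop 0<loop)
      ... | inj₂ 0<rest = widen (shortcut⊆ p e q e′ r) (go (shorter (shortcut-shorter p e q e′ r)) rest 0<rest)

    closedWalk⇒cycle : ∀ {x e es} → Walk G x x (e ∷ es) → ∃[ cy ] (IsCycle G cy × cy ⊆ e ∷ es)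
    closedWalk⇒cycle {e = e} {es} w =
      let cy , cycle , _ , cy⊆ = closedWalk⇒positiveCycle (λ _ → 1ℤ) w
                                   (subst (0ℤ <_) (sym (weight-1 (e ∷ es))) (+<+ (s≤s z≤n)))
      in cy , cycle , cy⊆

    longWalk⇒cycle : ∀ {x y es} → Walk G x y es → nV G ℕ.< length es → ∃[ cy ] (IsCycle G cy × cy ⊆ es)
    longWalk⇒cycle {es = es} w long with distinctOrRepeat _≟_ (tail G) es
    ... | distinct u = contradiction (distinctTails⇒length≤ u) (ℕP.<⇒≱ long)
    ... | repeat p e q e′ r same =
      let cy , cycle , cy⊆loop = closedWalk⇒cycle (proj₁ (cut-loop p same w))
      in cy , cycle , ⊆-trans cy⊆loop (loop⊆ p e q e′ r)

  -- Longest walks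

  module LongestWalks (G : Digraph) (c : Edge G → ℤ) where

    out : Vertex G → List (Edge G)
    out v = filter (λ e → tail G e ≟ v) (allFin (nE G))

    best : ℕ → Vertex G → ℤ
    bestVia : ℕ → Edge G → ℤ

    best zero    v = 0ℤ
    best (suc k) v = max 0ℤ (map (bestVia k) (out v))

    bestVia k e = c e + best k (head G e)

    walk≤best : ∀ k {v x} es → Walk G v x es → length es ℕ.≤ k → weight c es ≤ best k v
    walk≤best zero    []       refl       _         = ℤP.≤-refl
    walk≤best (suc k) {v} []   refl       _         = ⊥≤max 0ℤ (map (bestVia k) (out v))
    walk≤best (suc k) (e ∷ es) (refl , w) (s≤s len) =
      ℤP.≤-trans (ℤP.+-monoʳ-≤ (c e) (walk≤best k es w len))
                 (All.lookup (xs≤max 0ℤ (map (bestVia k) (out (tail G e))))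
                             (∈-map⁺ _ (∈-filter⁺ _ (∈-allFin e) refl)))

    best-attained : ∀ k v → ∃[ es ] ∃[ x ] (Walk G v x es × length es ℕ.≤ k × weight c es ≡ best k v)
    best-attained zero    v = [] , v , refl , z≤n , refl
    best-attained (suc k) v with argmax-sel id 0ℤ (map (bestVia k) (out v))
    ... | inj₁ best≡0 = [] , v , refl , z≤n , sym best≡0
    ... | inj₂ best∈
      with e , _ , best≡ , refl ← ∈-map∘filter⁻ (bestVia k) (λ e → tail G e ≟ v) {xs = allFin (nE G)} best∈
      with es , x , w , len , weight≡ ← best-attained k (head G e)
      = e ∷ es , x , (refl , w) , s≤s len , trans (cong (_+_ (c e)) weight≡) (sym best≡)

    heavyWalk⇒positiveCycle : ∀ {v x} es → Walk G v x es → length es ℕ.≤ suc (nV G) →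
                              best (nV G) v < weight c es → ∃[ cy ] (IsCycle G cy × 0ℤ < weight c cy)
    heavyWalk⇒positiveCycle es w len heavy with distinctOrRepeat _≟_ (tail G) es
    ... | distinct u = contradiction (walk≤best (nV G) es w (distinctTails⇒length≤ G u)) (ℤP.<⇒≱ heavy)
    ... | repeat p e q e′ r same with loop , rest ← cut-loop G p same w =
      let rest-short = ℕ.s≤s⁻¹ (ℕP.<-≤-trans (shortcut-shorter p e q e′ r) len)
          0<loop     = positive-summand (walk≤best (nV G) _ rest rest-short)
                                        (subst (_ <_) (weight-cut c p e q e′ r) heavy)
          cy , cycle , 0<cy , _ = closedWalk⇒positiveCycle G c loop 0<loop
      in cy , cycle , 0<cy

    feasibleAt? : ∀ e → Dec (bestVia (nV G) e ≤ best (nV G) (tail G e))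
    feasibleAt? e = bestVia (nV G) e ≤? best (nV G) (tail G e)

    feasiblePotential⊎positiveCycle :
      (∃[ q ] IsFeasiblePotential G c q) ⊎ (∃[ cy ] (IsCycle G cy × 0ℤ < weight c cy))
    feasiblePotential⊎positiveCycle with Fin.all? feasibleAt?
    ... | yes feasible = inj₁ (best (nV G) , feasible)
    ... | no infeasible
      with e , violated ← Fin.¬∀⟶∃¬ _ _ feasibleAt? infeasible
      with es , _ , w , len , weight≡ ← best-attained (nV G) (head G e)
      = inj₂ (heavyWalk⇒positiveCycle (e ∷ es) (refl , w) (s≤s len)
               (subst (best (nV G) (tail G e) <_) (cong (_+_ (c e)) (sym weight≡)) (ℤP.≰⇒> violated)))

  open LongestWalks using (feasiblePotential⊎positiveCycle)

  -- Circulations and their decomposition into cycles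

  module _ (G : Digraph) where

    residual : (Edge G → Bool) → Digraph
    residual f = record
      { nV   = nV G
      ; nE   = nE G
      ; tail = λ e → if f e then head G e else tail G e
      ; head = λ e → if f e then tail G e else head G e
      }

    Δ-residual : ∀ f q e → Δ (residual f) q e ≡ negateIf (f e) (Δ G q e)
    Δ-residual f q e with f e
    ... | true  = reverse (q (head G e)) (q (tail G e))
      where
      reverse : ∀ a b → b - a ≡ - (a - b)
      reverse = solve-∀
    ... | false = refl

    -- Balance at every vertex, in the form used throughout: every potential telescopes to 0 over f.
    IsCirculation : (Edge G → Bool) → Set
    IsCirculation f = ∀ q → ∑[ e < nE G ] (f e · Δ G q e) ≡ 0ℤ

    augment-isCirculation : ∀ {f cy} → IsCirculation f → IsCycle (residual f) cy → IsCirculation (f ⊕ cy)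
    augment-isCirculation {f} {cy} circ cycle q = begin
      ∑[ e < nE G ] ((f ⊕ cy) e · Δ G q e)
        ≡⟨ ∑-⊕ f (cycle-unique (residual f) cycle) (Δ G q) ⟩
      ∑[ e < nE G ] (f e · Δ G q e) + weight (λ e → negateIf (f e) (Δ G q e)) cy
        ≡⟨ cong₂ _+_ (circ q) (weight-cong cy (λ {e} _ → sym (Δ-residual f q e))) ⟩
      0ℤ + weight (Δ (residual f) q) cy
        ≡⟨ cong (_+_ 0ℤ) (cycle-Δ (residual f) q cycle) ⟩
      0ℤ
        ∎
      where open ≡-Reasoning

    removeCycle-isCirculation : ∀ {f cy} → IsCirculation f → IsCycle G cy → All (T ∘ f) cy →
                                IsCirculation (f ⊕ cy)
    removeCycle-isCirculation {f} {cy} circ cycle cy⊆f q = begin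
      S                              ≡⟨ ℤP.+-identityʳ S ⟨
      S + 0ℤ                         ≡⟨ cong (_+_ S) (cycle-Δ G q cycle) ⟨
      S + weight (Δ G q) cy          ≡⟨ ∑-⊖ f (cycle-unique G cycle) cy⊆f (Δ G q) ⟩
      ∑[ e < nE G ] (f e · Δ G q e)  ≡⟨ circ q ⟩
      0ℤ                             ∎
      where
      open ≡-Reasoning
      S : ℤ
      S = ∑[ e < nE G ] ((f ⊕ cy) e · Δ G q e)

    leavingEdge : ∀ {f} → IsCirculation f → ∀ {e} → T (f e) →
                  ∃[ e′ ] (T (f e′) × tail G e′ ≡ head G e)
    leavingEdge {f} circ {e} fe with Fin.any? (λ e′ → T? (f e′) ×-dec (tail G e′ ≟ head G e))
    ... | yes found = found
    ... | no  none  = contradiction (subst (1ℤ ≤_) (circ δ) 1≤∑) λ { (+≤+ ()) }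
      where
      -- The indicator potential of head e then sums to at least 1 over f: e contributes 1,
      -- and no edge of f leaves head e.
      δ : Vertex G → ℤ
      δ u = ⌊ u ≟ head G e ⌋ · 1ℤ

      Δδ : ∀ {e′} → T (f e′) → Δ G δ e′ ≡ δ (head G e′)
      Δδ {e′} fe′ =
        trans (cong (λ b → δ (head G e′) - b · 1ℤ) (isYes-false (tail G e′ ≟ head G e) (λ t → none (e′ , fe′ , t))))
              (ℤP.+-identityʳ _)

      0≤term : ∀ e′ → 0ℤ ≤ f e′ · Δ G δ e′
      0≤term e′ with f e′ in fe′
      ... | false = ℤP.≤-refl
      ... | true  = subst (0ℤ ≤_) (sym (Δδ (subst T (sym fe′) _))) (0≤b·1 _)

      δ≤term : ∀ e′ → ⌊ e′ ≟ e ⌋ · 1ℤ ≤ f e′ · Δ G δ e′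
      δ≤term e′ with e′ ≟ e
      ... | no  _    = 0≤term e′
      ... | yes refl =
        ℤP.≤-reflexive (sym (trans (·-T fe _) (trans (Δδ fe) (cong (_· 1ℤ) (isYes-true (head G e ≟ head G e) refl)))))

      1≤∑ : 1ℤ ≤ ∑[ e′ < nE G ] (f e′ · Δ G δ e′)
      1≤∑ = subst (_≤ ∑[ e′ < nE G ] (f e′ · Δ G δ e′)) (∑-δ e (λ _ → 1ℤ)) (∑-mono-≤ δ≤term)

    walkWithin : ∀ {f} → IsCirculation f → ∀ {e} → T (f e) → ∀ k →
                 ∃[ es ] ∃[ y ] (Walk G (tail G e) y es × length es ≡ suc k × All (T ∘ f) es)
    walkWithin circ {e} fe zero    = e ∷ [] , head G e , (refl , refl) , refl , fe ∷ []
    walkWithin circ {e} fe (suc k) =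
      let e′ , fe′ , leaves          = leavingEdge circ fe
          es , y , w , len , within = walkWithin circ fe′ k
      in e ∷ es , y , (refl , subst (λ u → Walk G u y es) leaves w) , cong suc len , fe ∷ within

    cycleWithin : ∀ {f} → IsCirculation f → ∀ {e} → T (f e) → ∃[ cy ] (IsCycle G cy × All (T ∘ f) cy)
    cycleWithin circ fe =
      let es , _ , w , len , within = walkWithin circ fe (nV G)
          cy , cycle , cy⊆es        = longWalk⇒cycle G w (ℕP.≤-reflexive (sym len))
      in cy , cycle , anti-mono cy⊆es within

    covers : List (List (Edge G)) → Edge G → Bool
    covers C e = any (e ∈ᵇ_) C

    Decomposition : (Edge G → Bool) → Set
    Decomposition f = ∃[ C ] (IsEdgeDisjointCycleCollection G C × ∀ e → covers C e ≡ f e)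

    decomposition-∷ : ∀ {f cy} → IsCycle G cy → All (T ∘ f) cy → Decomposition (f ⊕ cy) → Decomposition f
    decomposition-∷ {f} {cy} cycle cy⊆f (C , (cycles , disjoint) , covers≡) =
      cy ∷ C , (cycle ∷ cycles , All.tabulate apart ∷ disjoint) , covers-∷
      where
      apart : ∀ {c} → c ∈ C → EdgeDisjoint G cy c
      apart c∈C e e∈cy e∈c =
        xor-T (All.lookup cy⊆f e∈cy) (∈⇒∈ᵇ e∈cy) (subst T (covers≡ e) (any⁺ _ (lose c∈C (∈⇒∈ᵇ e∈c))))

      covers-∷ : ∀ e → covers (cy ∷ C) e ≡ f e
      covers-∷ e with e ∈ᵇ cy in e∈ᵇcy
      ... | true  = sym (Equivalence.to T-≡ (All.lookup cy⊆f (∈ᵇ⇒∈ (subst T (sym e∈ᵇcy) _))))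
      ... | false = trans (covers≡ e) (trans (cong (f e xor_) e∈ᵇcy) (xor-identityʳ (f e)))

    decompose : ∀ {f} → IsCirculation f → Acc ℕ._<_ ∣ tabulate f ∣ → Decomposition f
    decompose {f} circ (acc smaller) with Fin.any? (T? ∘ f)
    ... | no  empty    = [] , ([] , []) , λ e → sym (dec-false (T? (f e)) (λ fe → empty (e , fe)))
    ... | yes (e , fe) with cy , cycle , cy⊆f ← cycleWithin circ fe =
      decomposition-∷ cycle cy⊆f
        (decompose (removeCycle-isCirculation circ cycle cy⊆f) (smaller (shrinks cycle cy⊆f)))
      where
      shrinks : ∀ {cy} → IsCycle G cy → All (T ∘ f) cy → ∣ tabulate (f ⊕ cy) ∣ ℕ.< ∣ tabulate f ∣
      shrinks {cy@(_ ∷ _)} cycle cy⊆f =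
        subst (∣ tabulate (f ⊕ cy) ∣ ℕ.<_) (∣tabulate-⊖∣ f (cycle-unique G cycle) cy⊆f)
              (ℕP.m<m+n _ (s≤s z≤n))

  -- Optimal circulations and hitting sets

  module _ (G : Digraph) (w : Edge G → ℤ) where

    value : (Edge G → Bool) → ℤ
    value f = ∑[ e < nE G ] (f e · w e)

    residualWeight : (Edge G → Bool) → Edge G → ℤ
    residualWeight f e = negateIf (f e) (w e)

    Certified : (Edge G → Bool) → Set
    Certified f = IsCirculation G f × ∃[ q ] IsFeasiblePotential (residual G f) (residualWeight f) q

    value≤∑⁺ : ∀ f → value f ≤ ∑[ e < nE G ] (w e ⊔ 0ℤ)
    value≤∑⁺ f = ∑-mono-≤ (λ e → ·≤⊔0 (f e) (w e))
      where
      ·≤⊔0 : ∀ b x → b · x ≤ x ⊔ 0ℤ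
      ·≤⊔0 true  x = ℤP.i≤i⊔j x 0ℤ
      ·≤⊔0 false x = ℤP.i≤j⊔i x 0ℤ

    -- k bounds the number of augmentations still possible: each one raises the value by at least 1.
    certify : ∀ k {f} → IsCirculation G f → ∑[ e < nE G ] (w e ⊔ 0ℤ) < value f + + k → ∃[ f ] Certified f
    certify zero    {f} _    room =
      contradiction (value≤∑⁺ f) (ℤP.<⇒≱ (subst (_ <_) (ℤP.+-identityʳ (value f)) room))
    certify (suc k) {f} circ room with feasiblePotential⊎positiveCycle (residual G f) (residualWeight f)
    ... | inj₁ feasible             = f , circ , feasible
    ... | inj₂ (cy , cycle , 0<cy) =
      certify k (augment-isCirculation G circ cycle) (ℤP.<-≤-trans room improved)
      where
      open ℤP.≤-Reasoning
      improved : value f + + suc k ≤ value (f ⊕ cy) + + k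
      improved = begin
        value f + (1ℤ + + k)
          ≡⟨ ℤP.+-assoc (value f) 1ℤ (+ k) ⟨
        value f + 1ℤ + + k
          ≤⟨ ℤP.+-monoˡ-≤ (+ k) (ℤP.+-monoʳ-≤ (value f) (ℤP.i<j⇒suc[i]≤j 0<cy)) ⟩
        value f + weight (residualWeight f) cy + + k
          ≡⟨ cong (_+ + k) (∑-⊕ f (cycle-unique (residual G f) cycle) w) ⟨
        value (f ⊕ cy) + + k
          ∎

    optimalCirculation : ∃[ f ] Certified f
    optimalCirculation = certify (suc ℤ.∣ bound ∣) empty-isCirculation room
      where
      bound : ℤ
      bound = ∑[ e < nE G ] (w e ⊔ 0ℤ)

      empty-isCirculation : IsCirculation G (λ _ → false)
      empty-isCirculation q = sum-replicate-zero (nE G)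

      room : bound < value (λ _ → false) + + suc ℤ.∣ bound ∣
      room = subst (λ v → bound < v + + suc ℤ.∣ bound ∣) (sym (sum-replicate-zero (nE G)))
                   (ℤP.≤-<-trans (i≤+∣i∣ bound) (+<+ ℕP.≤-refl))

    reducedWeight : (Vertex G → ℤ) → Edge G → ℤ
    reducedWeight q e = w e + Δ G q e

    positivelyReduced : (Vertex G → ℤ) → Subset (nE G)
    positivelyReduced q = tabulate (λ e → ⌊ 0ℤ <? reducedWeight q e ⌋)

    positivelyReduced-hits : ∀ q {cy} → IsCycle G cy → 0ℤ < weight w cy → Hits G (positivelyReduced q) cy
    positivelyReduced-hits q {cy} cycle 0<cy =
      let e , e∈cy , 0<reduced = positive-term (reducedWeight q) cy (subst (0ℤ <_) reweigh 0<cy)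
      in e , e∈cy , lookup⇒[]= e _ (trans (lookup∘tabulate _ e)
                                          (isYes-true (0ℤ <? reducedWeight q e) 0<reduced))
      where
      open ≡-Reasoning
      reweigh : weight w cy ≡ weight (reducedWeight q) cy
      reweigh = begin
        weight w cy                        ≡⟨ ℤP.+-identityʳ (weight w cy) ⟨
        weight w cy + 0ℤ                   ≡⟨ cong (_+_ (weight w cy)) (cycle-Δ G q cycle) ⟨
        weight w cy + weight (Δ G q) cy    ≡⟨ weight-+ w (Δ G q) cy ⟨
        weight (reducedWeight q) cy        ∎

    [0<reduced]≤f·reduced : ∀ {f q} → IsFeasiblePotential (residual G f) (residualWeight f) q → ∀ e →
                            ⌊ 0ℤ <? reducedWeight q e ⌋ · 1ℤ ≤ f e · reducedWeight q e
    [0<reduced]≤f·reduced {f} {q} feasible e with f e | feasible e | 0ℤ <? reducedWeight q e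
    ... | false | forward  | yes 0<r = contradiction 0<r (ℤP.≤⇒≯ (forward⇒r≤0 forward))
      where
      forward⇒r≤0 : w e + q (head G e) ≤ q (tail G e) → reducedWeight q e ≤ 0ℤ
      forward⇒r≤0 h = subst (_≤ 0ℤ) (ℤP.+-assoc (w e) (q (head G e)) (- q (tail G e))) (ℤP.i≤j⇒i-j≤0 h)
    ... | false | _        | no  _   = ℤP.≤-refl
    ... | true  | _        | yes 0<r = ℤP.i<j⇒suc[i]≤j 0<r
    ... | true  | backward | no  _   =
      subst (0ℤ ≤_) (rearrange (w e) (q (head G e)) (q (tail G e))) (ℤP.i≤j⇒0≤j-i backward)
      where
      rearrange : ∀ a b c → b - (- a + c) ≡ a + (b - c)
      rearrange = solve-∀

    ∣positivelyReduced∣≤value : ∀ {f q} → IsCirculation G f →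
                                IsFeasiblePotential (residual G f) (residualWeight f) q →
                                + ∣ positivelyReduced q ∣ ≤ value f
    ∣positivelyReduced∣≤value {f} {q} circ feasible = begin
      + ∣ positivelyReduced q ∣
        ≡⟨ ∣tabulate∣≡∑ (λ e → ⌊ 0ℤ <? reducedWeight q e ⌋) ⟩
      ∑[ e < nE G ] (⌊ 0ℤ <? reducedWeight q e ⌋ · 1ℤ)
        ≤⟨ ∑-mono-≤ ([0<reduced]≤f·reduced {f} {q} feasible) ⟩
      ∑[ e < nE G ] (f e · reducedWeight q e)
        ≡⟨ sum-cong-≗ (λ e → ·-distrib-+ (f e) (w e) (Δ G q e)) ⟩
      ∑[ e < nE G ] (f e · w e + f e · Δ G q e)
        ≡⟨ ∑-distrib-+ (λ e → f e · w e) (λ e → f e · Δ G q e) ⟩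
      value f + ∑[ e < nE G ] (f e · Δ G q e)
        ≡⟨ cong (_+_ (value f)) (circ q) ⟩
      value f + 0ℤ
        ≡⟨ ℤP.+-identityʳ (value f) ⟩
      value f
        ∎
      where open ℤP.≤-Reasoning

  packing≥hitting : ∀ G (w : Edge G → ℤ) → ∃[ C ] ∃[ Y ]
    (IsEdgeDisjointCycleCollection G C
     × (∀ cy → IsCycle G cy → 0ℤ < weight w cy → Hits G Y cy)
     × + ∣ Y ∣ ≤ ∑[ e < nE G ] (lookup (EdgesOf G C) e · w e))
  packing≥hitting G w
    with f , circ , q , feasible ← optimalCirculation G w
    with C , collection , covers≡f ← decompose G circ (<-wellFounded _)
    = C , positivelyReduced G w q , collection , (λ _ → positivelyReduced-hits G w q) ,
      subst (+ ∣ positivelyReduced G w q ∣ ≤_) value≡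
            (∣positivelyReduced∣≤value G w {f} {q} circ feasible)
    where
    value≡ : value G w f ≡ ∑[ e < nE G ] (lookup (EdgesOf G C) e · w e)
    value≡ = sum-cong-≗ (λ e → cong (_· w e) (sym (trans (lookup∘tabulate _ e) (covers≡f e))))

  indicator : ∀ {n} → Subset n → Fin n → ℤ
  indicator p i = lookup p i · 1ℤ

  indicator-weight-positive : ∀ {n} {p : Subset n} {i xs} → i ∈ xs → i ∈ₛ p →
                              0ℤ < weight (indicator p) xs
  indicator-weight-positive {p = p} i∈xs i∈p =
    weight-positive (λ j → 0≤b·1 (lookup p j)) i∈xs
                    (subst (λ b → 0ℤ < b · 1ℤ) (sym ([]=⇒lookup i∈p)) (+<+ (s≤s z≤n)))

  ∑-indicator : ∀ {n} (p q : Subset n) → ∑[ i < n ] (lookup q i · indicator p i) ≡ + ∣ p ∩ q ∣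
  ∑-indicator {n} p q = sym (trans (∣p∣≡∑ (p ∩ q)) (sum-cong-≗ pointwise))
    where
    pointwise : ∀ i → lookup (p ∩ q) i · 1ℤ ≡ lookup q i · indicator p i
    pointwise i rewrite lookup-zipWith _∧_ i p q with lookup p i | lookup q i
    ... | true  | true  = refl
    ... | true  | false = refl
    ... | false | true  = refl
    ... | false | false = refl

open WeightedCycles using (packing≥hitting; indicator; indicator-weight-positive; ∑-indicator)
import Data.Integer.Properties as ℤP
open import Data.Nat using (_≤_)
open import Data.Fin.Subset using (Subset; _∩_; ∣_∣)
open import Data.List using (List)
open import Data.Fin using (Fin)
open import Data.Product using (_×_; _,_; ∃-syntax)

theorem2p2 : (D : Digraph) (F : Subset (nE D)) →
    ∃[ C ] ∃[ Y ] (IsEdgeDisjointCycleCollection D C × HitsAllFCycles D F Y × ∣ Y ∣ ≤ ∣ F ∩ EdgesOf D C ∣)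
theorem2p2 D F =
  let C , Y , collection , hits , ∣Y∣≤ = packing≥hitting D (indicator F)
  in C , Y , collection ,
     (λ { cy (cycle , e , e∈cy , e∈F) → hits cy cycle (indicator-weight-positive e∈cy e∈F) }) ,
     ℤP.drop‿+≤+ (ℤP.≤-trans ∣Y∣≤ (ℤP.≤-reflexive (∑-indicator F (EdgesOf D C))))
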